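{- Let $V$ be a finite set, $E\subseteq V\times V$, and $A\subseteq V$. Let $X=(V,E_X)$ and $Y=(V,E_Y)$ be directed graphs with $E_X\subseteq E_Y$ and $E_Y\setminus E_X\subseteq A\times V$, and let $e\in (A\times V)\setminus E$. Let $X^+=(V,E_X\cup\{e\})$ and $Y^+=(V,E_Y\cup\{e\})$. For a directed graph $Z$ on $V$, let $R(A,Z)$ denote the set of nodes reachable in $Z$ from some node of $A$ (including $A$ itself). Then $$|R(A,Y^+)|-|R(A,Y)|\ \le\ |R(A,X^+)|-|R(A,X)|.$$ -}

module Defs where

open import Data.Nat using (ℕ)
open import Data.Fin using (Fin)
open import Data.Fin.Subset using (Subset; _∈_)
open import Data.Product using (_×_; _,_)
open import Data.Sum using (_⊎_)
open import Function.Bundles using (_⇔_)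
open import Relation.Binary.PropositionalEquality using (_≡_)

NodeSet : ℕ → Set₁
NodeSet n = Fin n → Set

EdgeSet : ℕ → Set₁
EdgeSet n = Fin n × Fin n → Set

addEdge : ∀ {n} → EdgeSet n → Fin n × Fin n → EdgeSet n
addEdge E e p = E p ⊎ p ≡ e

data Reach {n : ℕ} (A : NodeSet n) (Z : EdgeSet n) : Fin n → Set where
  base : ∀ {v} → A v → Reach A Z v
  step : ∀ {u v} → Reach A Z u → Z (u , v) → Reach A Z v

IsReachSet : ∀ {n} → NodeSet n → EdgeSet n → Subset n → Set
IsReachSet A Z S = ∀ v → (v ∈ S) ⇔ Reach A Z v

module Submission where

-- Writing RX, RY, RX⁺, RY⁺ for the four reachable sets, the proof has a
-- combinatorial and a graph-theoretic half.
--   * Counting: for finite sets with x ⊆ y, x ⊆ x⁺ and y⁺ ⊆ y ∪ x⁺ we have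
--     |y⁺| + |x| ≤ |y| + |x⁺|, by inclusion–exclusion for |y ∪ x⁺| and
--     x ⊆ y ∩ x⁺.  The case
--     split on "reachable in X⁺" is decidable because RX⁺ is a finite set.

open import Defs
open import Data.Nat using (ℕ; suc) renaming (_≤_ to _≤ℕ_; _+_ to _+ℕ_)
import Data.Nat.Properties as ℕ
open import Data.Fin using (Fin)
open import Data.Fin.Subset using (Subset; ∣_∣; inside; outside; _⊆_; _∪_; _∩_)
open import Data.Fin.Subset.Properties using (_∈?_; x∈p∪q⁺; x∈p∩q⁺; p⊆q⇒∣p∣≤∣q∣)
open import Data.Vec.Base using ([]; _∷_)
open import Data.Product using (_×_; _,_; proj₁)
open import Data.Sum using (_⊎_; inj₁; inj₂)
import Data.Sum as Sum
open import Data.Integer using (ℤ; +_; _-_; _≤_; +≤+)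
import Data.Integer as ℤ
import Data.Integer.Properties as ℤP
open import Data.Integer.Tactic.RingSolver using (solve-∀)
open import Relation.Nullary using (¬_; Dec; yes; no)
import Relation.Nullary.Decidable as Dec
open import Relation.Binary.PropositionalEquality using (_≡_; refl; cong; sym; trans; module ≡-Reasoning)
open import Function.Bundles using (Equivalence)
open Equivalence using (to; from)

∣p∪q∣+∣p∩q∣≡∣p∣+∣q∣ : ∀ {n} (p q : Subset n) → ∣ p ∪ q ∣ +ℕ ∣ p ∩ q ∣ ≡ ∣ p ∣ +ℕ ∣ q ∣
∣p∪q∣+∣p∩q∣≡∣p∣+∣q∣ []            []            = refl
∣p∪q∣+∣p∩q∣≡∣p∣+∣q∣ (inside  ∷ p) (inside  ∷ q) =
  cong suc (begin
    ∣ p ∪ q ∣ +ℕ suc ∣ p ∩ q ∣  ≡⟨ ℕ.+-suc ∣ p ∪ q ∣ ∣ p ∩ q ∣ ⟩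
    suc (∣ p ∪ q ∣ +ℕ ∣ p ∩ q ∣) ≡⟨ cong suc (∣p∪q∣+∣p∩q∣≡∣p∣+∣q∣ p q) ⟩
    suc (∣ p ∣ +ℕ ∣ q ∣)         ≡⟨ ℕ.+-suc ∣ p ∣ ∣ q ∣ ⟨
    ∣ p ∣ +ℕ suc ∣ q ∣           ∎)
  where open ≡-Reasoning
∣p∪q∣+∣p∩q∣≡∣p∣+∣q∣ (inside  ∷ p) (outside ∷ q) = cong suc (∣p∪q∣+∣p∩q∣≡∣p∣+∣q∣ p q)
∣p∪q∣+∣p∩q∣≡∣p∣+∣q∣ (outside ∷ p) (inside  ∷ q) =
  trans (cong suc (∣p∪q∣+∣p∩q∣≡∣p∣+∣q∣ p q)) (sym (ℕ.+-suc ∣ p ∣ ∣ q ∣))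
∣p∪q∣+∣p∩q∣≡∣p∣+∣q∣ (outside ∷ p) (outside ∷ q) = ∣p∪q∣+∣p∩q∣≡∣p∣+∣q∣ p q

gain-bound : ∀ {n} (x y x⁺ y⁺ : Subset n)
  → x ⊆ y → x ⊆ x⁺ → y⁺ ⊆ y ∪ x⁺
  → ∣ y⁺ ∣ +ℕ ∣ x ∣ ≤ℕ ∣ y ∣ +ℕ ∣ x⁺ ∣
gain-bound x y x⁺ y⁺ x⊆y x⊆x⁺ y⁺⊆y∪x⁺ = begin
  ∣ y⁺ ∣ +ℕ ∣ x ∣              ≤⟨ ℕ.+-mono-≤ (p⊆q⇒∣p∣≤∣q∣ y⁺⊆y∪x⁺) (p⊆q⇒∣p∣≤∣q∣ x⊆y∩x⁺) ⟩
  ∣ y ∪ x⁺ ∣ +ℕ ∣ y ∩ x⁺ ∣     ≡⟨ ∣p∪q∣+∣p∩q∣≡∣p∣+∣q∣ y x⁺ ⟩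
  ∣ y ∣ +ℕ ∣ x⁺ ∣              ∎
  where
  open ℕ.≤-Reasoning
  x⊆y∩x⁺ : x ⊆ y ∩ x⁺
  x⊆y∩x⁺ i∈x = x∈p∩q⁺ (x⊆y i∈x , x⊆x⁺ i∈x)

difference-≤ : ∀ (a b c d : ℤ) → a ℤ.+ d ≤ b ℤ.+ c → a - b ≤ c - d
difference-≤ a b c d a+d≤b+c = begin
  a - b                        ≡⟨ add-right a b d ⟩
  (a ℤ.+ d) - (b ℤ.+ d)        ≤⟨ ℤP.+-monoˡ-≤ (ℤ.- (b ℤ.+ d)) a+d≤b+c ⟩
  (b ℤ.+ c) - (b ℤ.+ d)        ≡⟨ add-left c d b ⟨
  c - d                        ∎
  where
  open ℤP.≤-Reasoning
  add-right : ∀ (x y s : ℤ) → x - y ≡ (x ℤ.+ s) - (y ℤ.+ s)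
  add-right = solve-∀
  add-left : ∀ (x y s : ℤ) → x - y ≡ (s ℤ.+ x) - (s ℤ.+ y)
  add-left = solve-∀

_⊆ₑ_ : ∀ {n} → EdgeSet n → EdgeSet n → Set
Z ⊆ₑ Z' = ∀ p → Z p → Z' p

reach-mono : ∀ {n} {A : NodeSet n} {Z Z' : EdgeSet n} → Z ⊆ₑ Z' → ∀ {v} → Reach A Z v → Reach A Z' v
reach-mono Z⊆Z' (base a)   = base a
reach-mono Z⊆Z' (step r z) = step (reach-mono Z⊆Z' r) (Z⊆Z' _ z)

reachSet-mono : ∀ {n} {A : NodeSet n} {Z Z' : EdgeSet n} {S S' : Subset n}
  → IsReachSet A Z S → IsReachSet A Z' S' → Z ⊆ₑ Z' → S ⊆ S'
reachSet-mono isS isS' Z⊆Z' {v} v∈S = from (isS' v) (reach-mono Z⊆Z' (to (isS v) v∈S))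

addEdge-⊆ : ∀ {n} (Z : EdgeSet n) (e : Fin n × Fin n) → Z ⊆ₑ addEdge Z e
addEdge-⊆ Z e p = inj₁

-- Deciding reachability in X + e resolves whether the last edge lies in X.
reach-split : ∀ {n} {A : NodeSet n} {EX EY : EdgeSet n}
  → (∀ p → EY p → ¬ EX p → A (proj₁ p))
  → (e : Fin n × Fin n) → A (proj₁ e)
  → (∀ v → Dec (Reach A (addEdge EX e) v))
  → ∀ {v} → Reach A (addEdge EY e) v → Reach A EY v ⊎ Reach A (addEdge EX e) v
reach-split new⇒A e Ae reach? (base a)                   = inj₁ (base a)
reach-split new⇒A e Ae reach? (step r (inj₂ refl))       = inj₂ (step (base Ae) (inj₂ refl))
reach-split {EX = EX} new⇒A e Ae reach? {v} (step {u} r (inj₁ ey)) with reach-split new⇒A e Ae reach? r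
... | inj₁ ry = inj₁ (step ry ey)
... | inj₂ rx with reach? v
...   | yes rv = inj₂ rv
...   | no ¬rv = inj₁ (step (base (new⇒A _ ey not-in-X)) ey)
  where
  not-in-X : ¬ EX (u , v)
  not-in-X ex = ¬rv (step rx (inj₁ ex))

lemma5 : (n : ℕ) (E : EdgeSet n) (A : NodeSet n) (EX EY : EdgeSet n)
         → (∀ p → EX p → EY p)
         → (∀ p → EY p → ¬ EX p → A (proj₁ p))
         → (e : Fin n × Fin n) → A (proj₁ e) → ¬ E e
         → (RX RY RX⁺ RY⁺ : Subset n)
         → IsReachSet A EX RX → IsReachSet A EY RY
         → IsReachSet A (addEdge EX e) RX⁺ → IsReachSet A (addEdge EY e) RY⁺
         → (+ ∣ RY⁺ ∣) - (+ ∣ RY ∣) ≤ (+ ∣ RX⁺ ∣) - (+ ∣ RX ∣)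
lemma5 n E A EX EY X⊆Y new⇒A e Ae _ RX RY RX⁺ RY⁺ isX isY isX⁺ isY⁺ =
  difference-≤ (+ ∣ RY⁺ ∣) (+ ∣ RY ∣) (+ ∣ RX⁺ ∣) (+ ∣ RX ∣) in-ℤ
  where
  RX⊆RY : RX ⊆ RY
  RX⊆RY = reachSet-mono isX isY X⊆Y
  RX⊆RX⁺ : RX ⊆ RX⁺
  RX⊆RX⁺ = reachSet-mono isX isX⁺ (addEdge-⊆ EX e)
  reach? : ∀ v → Dec (Reach A (addEdge EX e) v)
  reach? v = Dec.map (isX⁺ v) (v ∈? RX⁺)
  RY⁺⊆RY∪RX⁺ : RY⁺ ⊆ RY ∪ RX⁺
  RY⁺⊆RY∪RX⁺ {v} v∈RY⁺ = x∈p∪q⁺ (Sum.map (from (isY v)) (from (isX⁺ v))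
    (reach-split new⇒A e Ae reach? (to (isY⁺ v) v∈RY⁺)))
  in-ℤ : + ∣ RY⁺ ∣ ℤ.+ + ∣ RX ∣ ≤ + ∣ RY ∣ ℤ.+ + ∣ RX⁺ ∣
  in-ℤ rewrite sym (ℤP.pos-+ ∣ RY⁺ ∣ ∣ RX ∣) | sym (ℤP.pos-+ ∣ RY ∣ ∣ RX⁺ ∣) =
    +≤+ (gain-bound RX RY RX⁺ RY⁺ RX⊆RY RX⊆RX⁺ RY⁺⊆RY∪RX⁺)
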